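{- Let $k \geq 2$ be fixed. For each $n$ let $G=G_n$ be an $n$-vertex graph with $e(G) = o(n^{3/2})$ as $n\to\infty$, and let $\mathcal A=(A_1,\ldots,A_k)$ be a partition of $V(G)$ into $k$ parts such that $\max_i |A_i| \leq n/k + o(\sqrt{n})$. Then for the complementary graph $\bar{G}$ we have $q_{\mathcal A}^D(\bar{G})= \frac1{k} + o(1/n)$.
   Context: For a graph $H=(V,E)$ with $m \geq 1$ edges and degrees $d_v$, for $A\subseteq V$ let ${\rm vol}_H(A)=\sum_{v\in A} d_v$. For a partition $\mathcal{A}$ of $V$, the degree tax is $q^D_{\mathcal A}(H)=\frac{1}{4m^2}\sum_{A\in\mathcal A}{\rm vol}_H(A)^2$. The complement $\bar G$ has the same vertex set as $G$ and exactly the non-edges of $G$ as edges. Asymptotic notation is as $n\to\infty$. -}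

module Defs where

open import Data.Bool using (Bool; true; false; not; if_then_else_; _∧_)
open import Data.Nat as ℕ using (ℕ; zero; suc; _+_; _*_; _<ᵇ_; _≡ᵇ_)
open import Data.Fin using (Fin; toℕ) renaming (zero to fzero; suc to fsuc)
open import Data.Fin.Properties using (_≟_)
open import Data.Integer using (+_)
open import Data.Rational using (ℚ; _/_; 0ℚ)
open import Relation.Nullary.Decidable using (⌊_⌋)
open import Relation.Binary.PropositionalEquality using (_≡_)

sumFin : (n : ℕ) → (Fin n → ℕ) → ℕ
sumFin zero    f = 0
sumFin (suc n) f = f fzero + sumFin n (λ i → f (fsuc i))

𝟙 : Bool → ℕ
𝟙 true  = 1
𝟙 false = 0

record Graph (n : ℕ) : Set where
  field
    adj   : Fin n → Fin n → Bool
    sym   : ∀ u v → adj u v ≡ adj v u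
    irrefl : ∀ v → adj v v ≡ false
open Graph public

adjC : ∀ {n} → Graph n → Fin n → Fin n → Bool
adjC G u v = not ⌊ u ≟ v ⌋ ∧ not (adj G u v)

edgesOf : ∀ {n} → (Fin n → Fin n → Bool) → ℕ
edgesOf {n} a = sumFin n (λ u → sumFin n (λ v → 𝟙 (a u v ∧ (toℕ u <ᵇ toℕ v))))

degOf : ∀ {n} → (Fin n → Fin n → Bool) → Fin n → ℕ
degOf {n} a v = sumFin n (λ u → 𝟙 (a v u))

partSize : ∀ {n k} → (Fin n → Fin k) → Fin k → ℕ
partSize {n} P i = sumFin n (λ v → 𝟙 ⌊ P v ≟ i ⌋)

vol : ∀ {n k} → (Fin n → Fin n → Bool) → (Fin n → Fin k) → Fin k → ℕ
vol {n} a P i = sumFin n (λ v → if ⌊ P v ≟ i ⌋ then degOf a v else 0)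

-- Degree tax q^D_A(H) = (1/(4m²)) Σ_{A} vol(A)²   (convention: 0 if m = 0,
-- where the paper's definition does not apply).
degreeTax : ∀ {n k} → (Fin n → Fin n → Bool) → (Fin n → Fin k) → ℚ
degreeTax {n} {k} a P with edgesOf a
... | zero  = 0ℚ
... | suc m = (+ sumFin k (λ i → vol a P i * vol a P i)) / (4 * suc m * suc m)

{-# OPTIONS --safe #-}
module Submission where

-- Write a_i = |A_i|, s_i = vol_G(A_i), v_i = vol_Ḡ(A_i) and e = e(G). Every vertex has n - 1
-- neighbours in G and Ḡ together, so v_i = (n-1)a_i - s_i and Σ v_i = 2e(Ḡ) = n(n-1) - 2e; hence
--   q^D_A(Ḡ) - 1/k = (k Σ v_i² - (Σ v_i)²) / (k (Σ v_i)²).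
-- The numerator is k² times the variance of (v_i): it is nonnegative and translation invariant.
-- Translating by n(n-1)/k leaves w_i = (n-1)(a_i - n/k) - s_i, so the numerator is at most
-- k Σ w_i² ≤ 2k(n-1)² Σ (a_i - n/k)² + 8k e². The excesses a_i - n/k sum to zero and their
-- positive parts are o(√n), so Σ (a_i - n/k)² = o(n); together with e² = o(n³) this gives
-- n Σ w_i² = o(n⁴), while (Σ v_i)² ≥ n⁴/4 once n ≥ 4 and e ≤ n²/8.

open import Defs hiding (sym)
open import Data.Bool using (Bool; true; false; not; if_then_else_; _∧_)
open import Data.Nat using (ℕ; zero; suc; _≥_; NonZero; _<ᵇ_)
import Data.Nat as ℕ
import Data.Nat.Properties as ℕP
open import Data.Fin using (Fin; toℕ) renaming (zero to fzero; suc to fsuc)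
open import Data.Fin.Properties using (_≟_; toℕ-injective)
open import Data.Empty using (⊥; ⊥-elim)
open import Function using (_∘_)
open import Relation.Nullary.Decidable using (⌊_⌋; yes; no)
open import Relation.Binary.PropositionalEquality
  using (_≡_; refl; sym; trans; cong; cong₂; subst; subst₂; module ≡-Reasoning)
import Algebra.Properties.Semiring.Sum as SemiringSum
import Algebra.Properties.Group as GroupProperties
open import Algebra.Bundles using (CommutativeRing)
open import Data.Integer as ℤ using (+_)
import Data.Integer.Properties as ℤP
open import Data.Nat.Coprimality using (1-coprimeTo) renaming (sym to coprime-sym)
open import Data.Rational
  using ( ℚ; mkℚ; _/_; 0ℚ; 1ℚ; _+_; _*_; -_; _-_; 1/_; _≤_; _<_; ∣_∣; _⊓_; _⊔_; *≤*
        ; positive; nonNegative; nonPositive)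
open import Data.Rational.Properties hiding (_≟_)
import Data.Rational.Unnormalised as ℚᵘ
import Data.Rational.Unnormalised.Properties as ℚᵘP
open import Data.Rational.Solver using (module +-*-Solver)
open +-*-Solver using (solve; _:=_; _:+_; _:-_; _:*_; con)
open import Data.Sum using (_⊎_; inj₁; inj₂)
import Data.Sum
open import Data.Product using (Σ; ∃; _,_; proj₁; proj₂)

module ℕΣ = SemiringSum ℕP.+-*-semiring
module ℚΣ = SemiringSum (CommutativeRing.semiring +-*-commutativeRing)
open ℚΣ using (sum; sum-syntax; sum-cong-≗; ∑-distrib-+; *-distribˡ-sum)
open GroupProperties +-0-group using (x∙y⁻¹≈ε⇒x≈y; ⁻¹-involutive)

sumFin≡sum : ∀ n (f : Fin n → ℕ) → sumFin n f ≡ ℕΣ.sum f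
sumFin≡sum zero    f = refl
sumFin≡sum (suc n) f = cong (f fzero ℕ.+_) (sumFin≡sum n (f ∘ fsuc))

sumFin-cong : ∀ n {f g : Fin n → ℕ} → (∀ i → f i ≡ g i) → sumFin n f ≡ sumFin n g
sumFin-cong n {f} {g} f≗g =
  trans (sumFin≡sum n f) (trans (ℕΣ.sum-cong-≗ f≗g) (sym (sumFin≡sum n g)))

sumFin-+ : ∀ n (f g : Fin n → ℕ) → sumFin n (λ i → f i ℕ.+ g i) ≡ sumFin n f ℕ.+ sumFin n g
sumFin-+ n f g rewrite sumFin≡sum n f | sumFin≡sum n g | sumFin≡sum n (λ i → f i ℕ.+ g i) =
  ℕΣ.∑-distrib-+ f g

sumFin-*ˡ : ∀ n c (f : Fin n → ℕ) → sumFin n (λ i → c ℕ.* f i) ≡ c ℕ.* sumFin n f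
sumFin-*ˡ n c f rewrite sumFin≡sum n f | sumFin≡sum n (λ i → c ℕ.* f i) =
  sym (ℕΣ.*-distribˡ-sum c f)

sumFin-comm : ∀ m n (f : Fin m → Fin n → ℕ) →
  sumFin m (λ u → sumFin n (f u)) ≡ sumFin n (λ v → sumFin m (λ u → f u v))
sumFin-comm m n f = begin
  sumFin m (λ u → sumFin n (f u))          ≡⟨ sumFin-cong m (λ u → sumFin≡sum n (f u)) ⟩
  sumFin m (λ u → ℕΣ.sum (f u))            ≡⟨ sumFin≡sum m _ ⟩
  ℕΣ.sum (λ u → ℕΣ.sum (f u))              ≡⟨ ℕΣ.∑-comm f ⟩
  ℕΣ.sum (λ v → ℕΣ.sum (λ u → f u v))      ≡⟨ sym (sumFin≡sum n _) ⟩
  sumFin n (λ v → ℕΣ.sum (λ u → f u v))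
    ≡⟨ sumFin-cong n (λ v → sym (sumFin≡sum m (λ u → f u v))) ⟩
  sumFin n (λ v → sumFin m (λ u → f u v))  ∎
  where open ≡-Reasoning

sumFin-const : ∀ n c → sumFin n (λ _ → c) ≡ n ℕ.* c
sumFin-const zero    c = refl
sumFin-const (suc n) c = cong (c ℕ.+_) (sumFin-const n c)

sumFin-δ : ∀ n (j : Fin n) x → sumFin n (λ i → if ⌊ j ≟ i ⌋ then x else 0) ≡ x
sumFin-δ (suc n) fzero    x =
  trans (cong (x ℕ.+_) (trans (sumFin-const n 0) (ℕP.*-zeroʳ n))) (ℕP.+-identityʳ x)
sumFin-δ (suc n) (fsuc j) x = trans (sumFin-cong n δ-suc) (sumFin-δ n j x)
  where
  δ-suc : ∀ i → (if ⌊ fsuc j ≟ fsuc i ⌋ then x else 0) ≡ (if ⌊ j ≟ i ⌋ then x else 0)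
  δ-suc i with j ≟ i
  ... | yes _ = refl
  ... | no  _ = refl

𝟙≡if : ∀ b → 𝟙 b ≡ (if b then 1 else 0)
𝟙≡if true  = refl
𝟙≡if false = refl

sumFin-over-parts : ∀ n k (P : Fin n → Fin k) (f : Fin n → ℕ) →
  sumFin k (λ i → sumFin n (λ v → if ⌊ P v ≟ i ⌋ then f v else 0)) ≡ sumFin n f
sumFin-over-parts n k P f =
  trans (sumFin-comm k n _) (sumFin-cong n (λ v → sumFin-δ k (P v) (f v)))

partSize-total : ∀ {n k} (P : Fin n → Fin k) → sumFin k (partSize P) ≡ n
partSize-total {n} {k} P = begin
  sumFin k (partSize P)
    ≡⟨ sumFin-cong k (λ i → sumFin-cong n (λ v → 𝟙≡if ⌊ P v ≟ i ⌋)) ⟩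
  sumFin k (λ i → sumFin n (λ v → if ⌊ P v ≟ i ⌋ then 1 else 0))
    ≡⟨ sumFin-over-parts n k P (λ _ → 1) ⟩
  sumFin n (λ _ → 1)
    ≡⟨ trans (sumFin-const n 1) (ℕP.*-identityʳ n) ⟩
  n ∎
  where open ≡-Reasoning

vol-total : ∀ {n k} (a : Fin n → Fin n → Bool) (P : Fin n → Fin k) →
  sumFin k (vol a P) ≡ sumFin n (degOf a)
vol-total {n} {k} a P = sumFin-over-parts n k P (degOf a)

<ᵇ-asym : ∀ m n → (m <ᵇ n) ≡ true → (n <ᵇ m) ≡ false
<ᵇ-asym zero    (suc n) _   = refl
<ᵇ-asym (suc m) (suc n) m<n = <ᵇ-asym m n m<n

<ᵇ-connex : ∀ m n → (m <ᵇ n) ≡ false → (n <ᵇ m) ≡ false → m ≡ n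
<ᵇ-connex zero    zero    _ _ = refl
<ᵇ-connex (suc m) (suc n) p q = cong suc (<ᵇ-connex m n p q)

handshake : ∀ {n} (G : Graph n) → edgesOf (adj G) ℕ.+ edgesOf (adj G) ≡ sumFin n (degOf (adj G))
handshake {n} G = sym (begin
  sumFin n (λ u → sumFin n (λ v → 𝟙 (adj G u v)))
    ≡⟨ sumFin-cong n (λ u → sumFin-cong n (λ v → sym (edge-split u v))) ⟩
  sumFin n (λ u → sumFin n (λ v → f u v ℕ.+ f v u))
    ≡⟨ sumFin-cong n (λ u → sumFin-+ n (f u) (λ v → f v u)) ⟩
  sumFin n (λ u → sumFin n (f u) ℕ.+ sumFin n (λ v → f v u))
    ≡⟨ sumFin-+ n _ _ ⟩
  edgesOf (adj G) ℕ.+ sumFin n (λ u → sumFin n (λ v → f v u))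
    ≡⟨ cong (edgesOf (adj G) ℕ.+_) (sumFin-comm n n (λ u v → f v u)) ⟩
  edgesOf (adj G) ℕ.+ edgesOf (adj G) ∎)
  where
  open ≡-Reasoning
  f : Fin n → Fin n → ℕ
  f u v = 𝟙 (adj G u v ∧ (toℕ u <ᵇ toℕ v))
  true≢false : true ≡ false → ⊥
  true≢false ()
  edge-split : ∀ u v → f u v ℕ.+ f v u ≡ 𝟙 (adj G u v)
  edge-split u v rewrite Graph.sym G v u with adj G u v in uv
  ... | false = refl
  ... | true with toℕ u <ᵇ toℕ v in u<v | toℕ v <ᵇ toℕ u in v<u
  ...   | true  | true  = ⊥-elim (true≢false (trans (sym v<u) (<ᵇ-asym (toℕ u) (toℕ v) u<v)))
  ...   | true  | false = refl
  ...   | false | true  = refl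
  ...   | false | false = ⊥-elim (true≢false (begin
    true        ≡⟨ sym uv ⟩
    adj G u v   ≡⟨ cong (adj G u) (toℕ-injective (sym (<ᵇ-connex (toℕ u) (toℕ v) u<v v<u))) ⟩
    adj G u u   ≡⟨ Graph.irrefl G u ⟩
    false       ∎))

complement : ∀ {n} → Graph n → Graph n
complement {n} G = record { adj = adjC G ; sym = adjC-sym ; irrefl = adjC-irrefl }
  where
  ≟-sym : ∀ (u v : Fin n) → ⌊ u ≟ v ⌋ ≡ ⌊ v ≟ u ⌋
  ≟-sym u v with u ≟ v | v ≟ u
  ... | yes _   | yes _   = refl
  ... | no  _   | no  _   = refl
  ... | yes u≡v | no  v≢u = ⊥-elim (v≢u (sym u≡v))
  ... | no  u≢v | yes v≡u = ⊥-elim (u≢v (sym v≡u))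
  adjC-sym : ∀ u v → adjC G u v ≡ adjC G v u
  adjC-sym u v = cong₂ _∧_ (cong not (≟-sym u v)) (cong not (Graph.sym G u v))
  adjC-irrefl : ∀ v → adjC G v v ≡ false
  adjC-irrefl v with v ≟ v
  ... | yes _   = refl
  ... | no  v≢v = ⊥-elim (v≢v refl)

degOf-complement : ∀ {n} (G : Graph n) v → degOf (adjC G) v ℕ.+ degOf (adj G) v ℕ.+ 1 ≡ n
degOf-complement {n} G v = begin
  degOf (adjC G) v ℕ.+ degOf (adj G) v ℕ.+ 1
    ≡⟨ cong (degOf (adjC G) v ℕ.+ degOf (adj G) v ℕ.+_) (sym (sumFin-δ n v 1)) ⟩
  degOf (adjC G) v ℕ.+ degOf (adj G) v ℕ.+ sumFin n δ
    ≡⟨ cong (ℕ._+ sumFin n δ) (sym (sumFin-+ n _ _)) ⟩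
  sumFin n (λ u → 𝟙 (adjC G v u) ℕ.+ 𝟙 (adj G v u)) ℕ.+ sumFin n δ
    ≡⟨ sym (sumFin-+ n _ _) ⟩
  sumFin n (λ u → 𝟙 (adjC G v u) ℕ.+ 𝟙 (adj G v u) ℕ.+ δ u)
    ≡⟨ sumFin-cong n exactly-one ⟩
  sumFin n (λ _ → 1)
    ≡⟨ trans (sumFin-const n 1) (ℕP.*-identityʳ n) ⟩
  n ∎
  where
  open ≡-Reasoning
  δ : Fin n → ℕ
  δ u = if ⌊ v ≟ u ⌋ then 1 else 0
  exactly-one : ∀ u → 𝟙 (adjC G v u) ℕ.+ 𝟙 (adj G v u) ℕ.+ δ u ≡ 1
  exactly-one u with v ≟ u
  ... | yes refl rewrite Graph.irrefl G v = refl
  ... | no  _ with adj G v u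
  ...   | true  = refl
  ...   | false = refl

vol-complement : ∀ {n k} (G : Graph n) (P : Fin n → Fin k) i →
  vol (adjC G) P i ℕ.+ vol (adj G) P i ℕ.+ partSize P i ≡ n ℕ.* partSize P i
vol-complement {n} G P i = begin
  vol (adjC G) P i ℕ.+ vol (adj G) P i ℕ.+ partSize P i
    ≡⟨ cong (ℕ._+ partSize P i) (sym (sumFin-+ n _ _)) ⟩
  sumFin n (λ v → in-part (degOf (adjC G) v) v ℕ.+ in-part (degOf (adj G) v) v) ℕ.+ partSize P i
    ≡⟨ sym (sumFin-+ n _ _) ⟩
  sumFin n (λ v → in-part (degOf (adjC G) v) v ℕ.+ in-part (degOf (adj G) v) v ℕ.+ 𝟙 (member v))
    ≡⟨ sumFin-cong n per-vertex ⟩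
  sumFin n (λ v → n ℕ.* 𝟙 (member v))
    ≡⟨ sumFin-*ˡ n n _ ⟩
  n ℕ.* partSize P i ∎
  where
  open ≡-Reasoning
  member : Fin _ → Bool
  member v = ⌊ P v ≟ i ⌋
  in-part : ℕ → Fin _ → ℕ
  in-part x v = if member v then x else 0
  per-vertex : ∀ v → in-part (degOf (adjC G) v) v ℕ.+ in-part (degOf (adj G) v) v ℕ.+ 𝟙 (member v)
                     ≡ n ℕ.* 𝟙 (member v)
  per-vertex v with member v
  ... | true  = trans (degOf-complement G v) (sym (ℕP.*-identityʳ n))
  ... | false = sym (ℕP.*-zeroʳ n)

fromℕ : ℕ → ℚ
fromℕ n = mkℚ (+ n) 0 (coprime-sym (1-coprimeTo n))

n/1≡fromℕ : ∀ n → + n / 1 ≡ fromℕ n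
n/1≡fromℕ n = normalize-coprime (coprime-sym (1-coprimeTo n))

fromℕ-homo-+ : ∀ m n → fromℕ (m ℕ.+ n) ≡ fromℕ m + fromℕ n
fromℕ-homo-+ m n = toℚᵘ-injective (ℚᵘP.≃-sym (ℚᵘP.≃-trans (toℚᵘ-homo-+ (fromℕ m) (fromℕ n))
  (ℚᵘ.*≡* (cong₂ ℤ._*_ (cong₂ ℤ._+_ (ℤP.*-identityʳ (+ m)) (ℤP.*-identityʳ (+ n))) refl))))

fromℕ-homo-* : ∀ m n → fromℕ (m ℕ.* n) ≡ fromℕ m * fromℕ n
fromℕ-homo-* m n = toℚᵘ-injective (ℚᵘP.≃-sym (ℚᵘP.≃-trans (toℚᵘ-homo-* (fromℕ m) (fromℕ n))
  (ℚᵘ.*≡* (cong₂ ℤ._*_ (sym (ℤP.pos-* m n)) refl))))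

fromℕ-mono-≤ : ∀ {m n} → m ℕ.≤ n → fromℕ m ≤ fromℕ n
fromℕ-mono-≤ {m} {n} m≤n =
  *≤* (subst₂ ℤ._≤_ (sym (ℤP.*-identityʳ (+ m))) (sym (ℤP.*-identityʳ (+ n))) (ℤ.+≤+ m≤n))

0≤fromℕ : ∀ n → 0ℚ ≤ fromℕ n
0≤fromℕ n = fromℕ-mono-≤ ℕ.z≤n

n³/1≡fromℕ³ : ∀ n → + (n ℕ.* n ℕ.* n) / 1 ≡ fromℕ n * fromℕ n * fromℕ n
n³/1≡fromℕ³ n = trans (n/1≡fromℕ (n ℕ.* n ℕ.* n))
  (trans (fromℕ-homo-* (n ℕ.* n) n) (cong (_* fromℕ n) (fromℕ-homo-* n n)))

0≤n/d : ∀ n d → 0ℚ ≤ + n / suc d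
0≤n/d n d = nonNegative⁻¹ (+ n / suc d) {{normalize-nonNeg n (suc d)}}

n/d≡fromℕ*1/fromℕ : ∀ n d → + n / suc d ≡ fromℕ n * 1/ fromℕ (suc d)
n/d≡fromℕ*1/fromℕ n d = begin
  + n / suc d                ≡⟨ sym (*-identityʳ (+ n / suc d)) ⟩
  + n / suc d * 1ℚ           ≡⟨ cong (+ n / suc d *_) (sym (*-inverseʳ D)) ⟩
  + n / suc d * (D * 1/ D)   ≡⟨ sym (*-assoc (+ n / suc d) D (1/ D)) ⟩
  (+ n / suc d * D) * 1/ D   ≡⟨ cong (_* 1/ D) cancel ⟩
  fromℕ n * 1/ D             ∎
  where
  open ≡-Reasoning
  D = fromℕ (suc d)
  cancel : + n / suc d * D ≡ fromℕ n
  cancel = toℚᵘ-injective (ℚᵘP.≃-trans (toℚᵘ-homo-* (+ n / suc d) D)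
    (ℚᵘP.≃-trans (ℚᵘP.*-congʳ (toℚᵘ-fromℚᵘ (ℚᵘ.mkℚᵘ (+ n) d)))
      (ℚᵘ.*≡* (ℤP.*-assoc (+ n) (+ suc d) (+ 1)))))

≤-by-slack : ∀ {p q} x → 0ℚ ≤ x → p + x ≡ q → p ≤ q
≤-by-slack {p} x 0≤x p+x≡q = subst₂ _≤_ (+-identityʳ p) p+x≡q (+-monoʳ-≤ p 0≤x)

p≤q⇒0≤q-p : ∀ {p q} → p ≤ q → 0ℚ ≤ q - p
p≤q⇒0≤q-p {p} {q} p≤q = subst (_≤ q - p) (+-inverseʳ p) (+-monoˡ-≤ (- p) p≤q)

*-pos : ∀ {p q} → 0ℚ < p → 0ℚ < q → 0ℚ < p * q
*-pos {p} {q} 0<p 0<q = positive⁻¹ (p * q) {{pos*pos⇒pos p {{positive 0<p}} q {{positive 0<q}}}}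

*-nonNeg : ∀ {p q} → 0ℚ ≤ p → 0ℚ ≤ q → 0ℚ ≤ p * q
*-nonNeg {p} {q} 0≤p 0≤q =
  nonNegative⁻¹ (p * q) {{nonNeg*nonNeg⇒nonNeg p {{nonNegative 0≤p}} q {{nonNegative 0≤q}}}}

0≤p*p : ∀ p → 0ℚ ≤ p * p
0≤p*p p with ≤-total 0ℚ p
... | inj₁ 0≤p = *-nonNeg 0≤p 0≤p
... | inj₂ p≤0 =
  nonNegative⁻¹ (p * p) {{nonPos*nonPos⇒nonPos p {{nonPositive p≤0}} p {{nonPositive p≤0}}}}

0<⊓ : ∀ {p q} → 0ℚ < p → 0ℚ < q → 0ℚ < p ⊓ q
0<⊓ {p} {q} 0<p 0<q with ⊓-sel p q
... | inj₁ p⊓q≡p = subst (0ℚ <_) (sym p⊓q≡p) 0<p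
... | inj₂ p⊓q≡q = subst (0ℚ <_) (sym p⊓q≡q) 0<q

*-monoˡ-≤-0≤ : ∀ {r p q} → 0ℚ ≤ r → p ≤ q → r * p ≤ r * q
*-monoˡ-≤-0≤ {r} 0≤r = *-monoˡ-≤-nonNeg r {{nonNegative 0≤r}}

*-monoʳ-≤-0≤ : ∀ {r p q} → 0ℚ ≤ r → p ≤ q → p * r ≤ q * r
*-monoʳ-≤-0≤ {r} 0≤r = *-monoʳ-≤-nonNeg r {{nonNegative 0≤r}}

*-mono-≤-0≤ : ∀ {p q r s} → 0ℚ ≤ p → p ≤ q → 0ℚ ≤ r → r ≤ s → p * r ≤ q * s
*-mono-≤-0≤ 0≤p p≤q 0≤r r≤s =
  ≤-trans (*-monoˡ-≤-0≤ 0≤p r≤s) (*-monoʳ-≤-0≤ (≤-trans 0≤r r≤s) p≤q)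

p*p≤q*q⇒p≤q : ∀ {p q} → 0ℚ ≤ q → p * p ≤ q * q → p ≤ q
p*p≤q*q⇒p≤q {p} {q} 0≤q p²≤q² with p ≤? q
... | yes p≤q = p≤q
... | no  p≰q = ⊥-elim (<-irrefl refl (<-≤-trans q²<p² p²≤q²))
  where
  q<p = ≰⇒> p≰q
  q²<p² : q * q < p * p
  q²<p² = ≤-<-trans (*-monoˡ-≤-0≤ 0≤q (<⇒≤ q<p))
                    (*-monoˡ-<-pos p {{positive (≤-<-trans 0≤q q<p)}} q<p)

double-square : ∀ y → (y + y) * (y + y) ≡ fromℕ 4 * (y * y)
double-square = solve 1 (λ y → (y :+ y) :* (y :+ y) := con (fromℕ 4) :* (y :* y)) refl

sq-diff≤ : ∀ p q → (p - q) * (p - q) ≤ fromℕ 2 * (p * p) + fromℕ 2 * (q * q)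
sq-diff≤ p q = ≤-by-slack ((p + q) * (p + q)) (0≤p*p (p + q)) (parallelogram p q)
  where
  parallelogram : ∀ p q → (p - q) * (p - q) + (p + q) * (p + q) ≡ fromℕ 2 * (p * p) + fromℕ 2 * (q * q)
  parallelogram = solve 2 (λ p q → (p :- q) :* (p :- q) :+ (p :+ q) :* (p :+ q)
                                 := con (fromℕ 2) :* (p :* p) :+ con (fromℕ 2) :* (q :* q)) refl

fromℕ-sumFin : ∀ n (f : Fin n → ℕ) → fromℕ (sumFin n f) ≡ ∑[ i < n ] fromℕ (f i)
fromℕ-sumFin zero    f = refl
fromℕ-sumFin (suc n) f =
  trans (fromℕ-homo-+ (f fzero) _) (cong (_+_ (fromℕ (f fzero))) (fromℕ-sumFin n (f ∘ fsuc)))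

sum-const : ∀ k c → ∑[ i < k ] c ≡ fromℕ k * c
sum-const zero    c = sym (*-zeroˡ c)
sum-const (suc k) c = begin
  c + ∑[ i < k ] c    ≡⟨ cong (_+_ c) (sum-const k c) ⟩
  c + fromℕ k * c     ≡⟨ factor (fromℕ k) c ⟩
  (1ℚ + fromℕ k) * c  ≡⟨ cong (_* c) (sym (fromℕ-homo-+ 1 k)) ⟩
  fromℕ (suc k) * c   ∎
  where
  open ≡-Reasoning
  factor : ∀ K c → c + K * c ≡ (1ℚ + K) * c
  factor = solve 2 (λ K c → c :+ K :* c := (con 1ℚ :+ K) :* c) refl

∑-distrib-− : ∀ {k} (f g : Fin k → ℚ) → ∑[ i < k ] (f i - g i) ≡ sum f - sum g
∑-distrib-− {zero}  f g = refl
∑-distrib-− {suc k} f g =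
  trans (cong (_+_ (f fzero - g fzero)) (∑-distrib-− (f ∘ fsuc) (g ∘ fsuc)))
        (regroup (f fzero) (g fzero) (sum (f ∘ fsuc)) (sum (g ∘ fsuc)))
  where
  regroup : ∀ a b c d → a - b + (c - d) ≡ a + c - (b + d)
  regroup = solve 4 (λ a b c d → a :- b :+ (c :- d) := a :+ c :- (b :+ d)) refl

∑-mono-≤ : ∀ {k} {f g : Fin k → ℚ} → (∀ i → f i ≤ g i) → sum f ≤ sum g
∑-mono-≤ {zero}  f≤g = ≤-refl
∑-mono-≤ {suc k} f≤g = +-mono-≤ (f≤g fzero) (∑-mono-≤ (f≤g ∘ fsuc))

∑-nonNeg : ∀ {k} {f : Fin k → ℚ} → (∀ i → 0ℚ ≤ f i) → 0ℚ ≤ sum f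
∑-nonNeg {zero}  0≤f = ≤-refl
∑-nonNeg {suc k} 0≤f = +-mono-≤ (0≤f fzero) (∑-nonNeg (0≤f ∘ fsuc))

sum-sq≤sq-sum : ∀ {k} (f : Fin k → ℚ) → (∀ i → 0ℚ ≤ f i) →
  ∑[ i < k ] (f i * f i) ≤ sum f * sum f
sum-sq≤sq-sum {zero}  f 0≤f = ≤-refl
sum-sq≤sq-sum {suc k} f 0≤f = begin
  a * a + ∑[ i < k ] (f (fsuc i) * f (fsuc i))
    ≤⟨ +-monoʳ-≤ (a * a) (sum-sq≤sq-sum (f ∘ fsuc) (0≤f ∘ fsuc)) ⟩
  a * a + S * S
    ≤⟨ ≤-by-slack (a * S + a * S) (+-mono-≤ 0≤aS 0≤aS) (expand a S) ⟩
  (a + S) * (a + S) ∎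
  where
  open ≤-Reasoning
  a = f fzero
  S = sum (f ∘ fsuc)
  0≤aS = *-nonNeg (0≤f fzero) (∑-nonNeg (0≤f ∘ fsuc))
  expand : ∀ a S → a * a + S * S + (a * S + a * S) ≡ (a + S) * (a + S)
  expand = solve 2 (λ a S → a :* a :+ S :* S :+ (a :* S :+ a :* S) := (a :+ S) :* (a :+ S)) refl

scaledVariance : ∀ {k} → (Fin k → ℚ) → ℚ
scaledVariance {k} v = fromℕ k * ∑[ i < k ] (v i * v i) - sum v * sum v

scaledVariance-cong : ∀ {k} {f g : Fin k → ℚ} → (∀ i → f i ≡ g i) →
  scaledVariance f ≡ scaledVariance g
scaledVariance-cong {k} f≗g = cong₂ (λ Q S → fromℕ k * Q - S * S)
  (sum-cong-≗ (λ i → cong₂ _*_ (f≗g i) (f≗g i))) (sum-cong-≗ f≗g)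

scaledVariance-translate : ∀ {k} c (w : Fin k → ℚ) →
  scaledVariance (λ i → c + w i) ≡ scaledVariance w
scaledVariance-translate {k} c w = begin
  K * ∑[ i < k ] ((c + w i) * (c + w i)) - ∑[ i < k ] (c + w i) * ∑[ i < k ] (c + w i)
    ≡⟨ cong₂ (λ Q S → K * Q - S * S) sum-sq sum-lin ⟩
  K * (K * (c * c) + (c + c) * sum w + W) - (K * c + sum w) * (K * c + sum w)
    ≡⟨ cancel K c (sum w) W ⟩
  K * W - sum w * sum w ∎
  where
  open ≡-Reasoning
  K = fromℕ k
  W = ∑[ i < k ] (w i * w i)
  sum-lin : ∑[ i < k ] (c + w i) ≡ K * c + sum w
  sum-lin = trans (∑-distrib-+ (λ _ → c) w) (cong (_+ sum w) (sum-const k c))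
  square-+ : ∀ c w → (c + w) * (c + w) ≡ c * c + (c + c) * w + w * w
  square-+ = solve 2 (λ c w → (c :+ w) :* (c :+ w) := c :* c :+ (c :+ c) :* w :+ w :* w) refl
  sum-sq : ∑[ i < k ] ((c + w i) * (c + w i)) ≡ K * (c * c) + (c + c) * sum w + W
  sum-sq = begin
    ∑[ i < k ] ((c + w i) * (c + w i))
      ≡⟨ sum-cong-≗ (λ i → square-+ c (w i)) ⟩
    ∑[ i < k ] (c * c + (c + c) * w i + w i * w i)
      ≡⟨ ∑-distrib-+ (λ i → c * c + (c + c) * w i) (λ i → w i * w i) ⟩
    ∑[ i < k ] (c * c + (c + c) * w i) + W
      ≡⟨ cong (_+ W) (∑-distrib-+ (λ _ → c * c) (λ i → (c + c) * w i)) ⟩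
    ∑[ i < k ] (c * c) + ∑[ i < k ] ((c + c) * w i) + W
      ≡⟨ cong₂ (λ A B → A + B + W) (sum-const k (c * c)) (sym (*-distribˡ-sum (c + c) w)) ⟩
    K * (c * c) + (c + c) * sum w + W ∎
  cancel : ∀ K c S W → K * (K * (c * c) + (c + c) * S + W) - (K * c + S) * (K * c + S) ≡ K * W - S * S
  cancel = solve 4 (λ K c S W → K :* (K :* (c :* c) :+ (c :+ c) :* S :+ W) :- (K :* c :+ S) :* (K :* c :+ S)
                              := K :* W :- S :* S) refl

scaledVariance-nonNeg : ∀ {k} (v : Fin k → ℚ) → 0ℚ ≤ scaledVariance v
scaledVariance-nonNeg {zero}  v = ≤-refl
scaledVariance-nonNeg {suc k} v = begin
  0ℚ                                 ≤⟨ 0≤K*∑w² ⟩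
  K * ∑[ i < suc k ] (w i * w i)     ≡⟨ sym (drop-zero-square _ (sum w) sum-w≡0) ⟩
  scaledVariance w                   ≡⟨ sym (scaledVariance-translate mean w) ⟩
  scaledVariance (λ i → mean + w i)  ≡⟨ scaledVariance-cong (λ i → recentre (v i) mean) ⟩
  scaledVariance v                   ∎
  where
  open ≤-Reasoning
  K = fromℕ (suc k)
  mean = sum v * 1/ K
  w : Fin (suc k) → ℚ
  w i = v i - mean
  0≤K*∑w² = *-nonNeg (0≤fromℕ (suc k)) (∑-nonNeg (λ i → 0≤p*p (w i)))
  recentre : ∀ x m → m + (x - m) ≡ x
  recentre = solve 2 (λ x m → m :+ (x :- m) := x) refl
  drop-zero-square : ∀ X S → S ≡ 0ℚ → X - S * S ≡ X
  drop-zero-square X S refl = +-identityʳ X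
  factor : ∀ S K r → S - K * (S * r) ≡ S * (1ℚ - K * r)
  factor = solve 3 (λ S K r → S :- K :* (S :* r) := S :* (con 1ℚ :- K :* r)) refl
  sum-w≡0 : sum w ≡ 0ℚ
  sum-w≡0 = begin-equality
    sum w                        ≡⟨ ∑-distrib-− v (λ _ → mean) ⟩
    sum v - ∑[ i < suc k ] mean  ≡⟨ cong (λ y → sum v - y) (sum-const (suc k) mean) ⟩
    sum v - K * (sum v * 1/ K)   ≡⟨ factor (sum v) K (1/ K) ⟩
    sum v * (1ℚ - K * 1/ K)      ≡⟨ cong (λ y → sum v * (1ℚ - y)) (*-inverseʳ K) ⟩
    sum v * (1ℚ - 1ℚ)            ≡⟨ *-zeroʳ (sum v) ⟩
    0ℚ                           ∎

scaledVariance≤k*sum-sq : ∀ {k} (w : Fin k → ℚ) →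
  scaledVariance w ≤ fromℕ k * ∑[ i < k ] (w i * w i)
scaledVariance≤k*sum-sq {k} w = ≤-by-slack (sum w * sum w) (0≤p*p (sum w))
  (add-back (fromℕ k * ∑[ i < k ] (w i * w i)) (sum w * sum w))
  where
  add-back : ∀ A B → A - B + B ≡ A
  add-back = solve 2 (λ A B → A :- B :+ B := A) refl

cauchy-schwarz : ∀ {k} (t : Fin k → ℚ) → sum t * sum t ≤ fromℕ k * ∑[ i < k ] (t i * t i)
cauchy-schwarz {k} t = ≤-by-slack (scaledVariance t) (scaledVariance-nonNeg t)
  (add-back (sum t * sum t) (fromℕ k * ∑[ i < k ] (t i * t i)))
  where
  add-back : ∀ S Q → S + (Q - S) ≡ Q
  add-back = solve 2 (λ S Q → S :+ (Q :- S) := Q) refl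

⊔0-split : ∀ x → (x ⊔ 0ℚ) - ((- x) ⊔ 0ℚ) ≡ x
⊔0-split x with ≤-total 0ℚ x
... | inj₁ 0≤x rewrite p≥q⇒p⊔q≡p 0≤x | p≤q⇒p⊔q≡q (neg-antimono-≤ 0≤x) = +-identityʳ x
... | inj₂ x≤0 rewrite p≤q⇒p⊔q≡q x≤0 | p≥q⇒p⊔q≡p (neg-antimono-≤ x≤0) =
  trans (+-identityˡ (- (- x))) (⁻¹-involutive x)

⊔0-sq-bound : ∀ x B → 0ℚ ≤ B → (x ≤ 0ℚ) ⊎ (x * x ≤ B) → (x ⊔ 0ℚ) * (x ⊔ 0ℚ) ≤ B
⊔0-sq-bound x B 0≤B x≤0∨x²≤B with ≤-total 0ℚ x
... | inj₂ x≤0 rewrite p≤q⇒p⊔q≡q x≤0 = 0≤B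
... | inj₁ 0≤x rewrite p≥q⇒p⊔q≡p 0≤x with x≤0∨x²≤B
...   | inj₂ x²≤B = x²≤B
...   | inj₁ x≤0 rewrite ≤-antisym x≤0 0≤x = 0≤B

-- A zero sum lets the positive parts, which are bounded, also control the negative ones.
balanced-sum-sq-bound : ∀ {k} (x : Fin k → ℚ) B → 0ℚ ≤ B → sum x ≡ 0ℚ →
  (∀ i → (x i ≤ 0ℚ) ⊎ (x i * x i ≤ B)) →
  ∑[ i < k ] (x i * x i) ≤ fromℕ 4 * (fromℕ k * (fromℕ k * B))
balanced-sum-sq-bound {k} x B 0≤B sum-x≡0 one-sided = begin
  ∑[ i < k ] (x i * x i)
    ≤⟨ ∑-mono-≤ x²≤[p+q]² ⟩
  ∑[ i < k ] ((p i + q i) * (p i + q i))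
    ≤⟨ sum-sq≤sq-sum (λ i → p i + q i) (λ i → +-mono-≤ (0≤p i) (0≤q i)) ⟩
  sum (λ i → p i + q i) * sum (λ i → p i + q i)
    ≡⟨ cong (λ S → S * S) (trans (∑-distrib-+ p q) (cong (_+_ (sum p)) (sym sum-p≡sum-q))) ⟩
  (sum p + sum p) * (sum p + sum p)
    ≡⟨ double-square (sum p) ⟩
  fromℕ 4 * (sum p * sum p)
    ≤⟨ *-monoˡ-≤-0≤ (0≤fromℕ 4)
         (≤-trans (cauchy-schwarz p) (*-monoˡ-≤-0≤ (0≤fromℕ k) sum-p²≤K*B)) ⟩
  fromℕ 4 * (K * (K * B)) ∎
  where
  open ≤-Reasoning
  K = fromℕ k
  p q : Fin k → ℚ
  p i = x i ⊔ 0ℚ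
  q i = (- x i) ⊔ 0ℚ
  0≤p : ∀ i → 0ℚ ≤ p i
  0≤p i = p≤q⊔p (x i) 0ℚ
  0≤q : ∀ i → 0ℚ ≤ q i
  0≤q i = p≤q⊔p (- x i) 0ℚ
  square-sum : ∀ a b → (a - b) * (a - b) + fromℕ 4 * (a * b) ≡ (a + b) * (a + b)
  square-sum = solve 2 (λ a b →
    (a :- b) :* (a :- b) :+ con (fromℕ 4) :* (a :* b) := (a :+ b) :* (a :+ b)) refl
  x²≤[p+q]² : ∀ i → x i * x i ≤ (p i + q i) * (p i + q i)
  x²≤[p+q]² i = begin
    x i * x i                  ≡⟨ cong (λ y → y * y) (sym (⊔0-split (x i))) ⟩
    (p i - q i) * (p i - q i)  ≤⟨ ≤-by-slack _ (*-nonNeg (0≤fromℕ 4) (*-nonNeg (0≤p i) (0≤q i)))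
                                    (square-sum (p i) (q i)) ⟩
    (p i + q i) * (p i + q i)  ∎
  sum-p≡sum-q : sum p ≡ sum q
  sum-p≡sum-q = x∙y⁻¹≈ε⇒x≈y (sum p) (sum q) (begin-equality
    sum p - sum q           ≡⟨ sym (∑-distrib-− p q) ⟩
    ∑[ i < k ] (p i - q i)  ≡⟨ sum-cong-≗ (λ i → ⊔0-split (x i)) ⟩
    sum x                   ≡⟨ sum-x≡0 ⟩
    0ℚ                      ∎)
  sum-p²≤K*B : ∑[ i < k ] (p i * p i) ≤ K * B
  sum-p²≤K*B = ≤-trans (∑-mono-≤ (λ i → ⊔0-sq-bound (x i) B 0≤B (one-sided i)))
                       (≤-reflexive (sum-const k B))

edges-≤-n²/8 : ∀ {n e ε} → 1ℚ ≤ n → ε ≤ 1ℚ → e * e ≤ ε * (+ 1 / 64) * (n * n * n) →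
  e ≤ n * n * (+ 1 / 8)
edges-≤-n²/8 {n} {e} {ε} 1≤n ε≤1 e²≤εn³/64 = p*p≤q*q⇒p≤q (*-nonNeg 0≤n² (0≤n/d 1 7)) (begin
  e * e                    ≤⟨ e²≤εn³/64 ⟩
  ε * (+ 1 / 64) * n³      ≤⟨ *-monoʳ-≤-0≤ 0≤n³ (*-monoʳ-≤-nonNeg (+ 1 / 64) ε≤1) ⟩
  1ℚ * (+ 1 / 64) * n³     ≤⟨ ≤-by-slack _ (*-nonNeg (0≤n/d 1 63) (*-nonNeg 0≤n³ (p≤q⇒0≤q-p 1≤n)))
                                (fill-to-n⁴ n) ⟩
  n * n * (+ 1 / 8) * (n * n * (+ 1 / 8)) ∎)
  where
  open ≤-Reasoning
  0≤n = ≤-trans (≤ᵇ⇒≤ _) 1≤n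
  0≤n² = *-nonNeg 0≤n 0≤n
  n³ = n * n * n
  0≤n³ = *-nonNeg 0≤n² 0≤n
  fill-to-n⁴ : ∀ n → 1ℚ * (+ 1 / 64) * (n * n * n) + (+ 1 / 64) * ((n * n * n) * (n - 1ℚ))
              ≡ n * n * (+ 1 / 8) * (n * n * (+ 1 / 8))
  fill-to-n⁴ = solve 1 (λ n → con 1ℚ :* con (+ 1 / 64) :* (n :* n :* n)
                          :+ con (+ 1 / 64) :* (n :* n :* n :* (n :- con 1ℚ))
                       := n :* n :* con (+ 1 / 8) :* (n :* n :* con (+ 1 / 8))) refl

n²/2≤n[n-1]-2e : ∀ {n e} → fromℕ 4 ≤ n → e ≤ n * n * (+ 1 / 8) →
  n * n * (+ 1 / 2) ≤ n * (n - 1ℚ) - (e + e)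
n²/2≤n[n-1]-2e {n} {e} 4≤n e≤n²/8 = ≤-by-slack
  (n * (n - fromℕ 4) * (+ 1 / 4) + fromℕ 2 * (n * n * (+ 1 / 8) - e))
  (+-mono-≤ (*-nonNeg (*-nonNeg (≤-trans (0≤fromℕ 4) 4≤n) (p≤q⇒0≤q-p 4≤n)) (0≤n/d 1 3))
            (*-nonNeg (0≤fromℕ 2) (p≤q⇒0≤q-p e≤n²/8)))
  (identity n e)
  where
  identity : ∀ n e → n * n * (+ 1 / 2) + (n * (n - fromℕ 4) * (+ 1 / 4) + fromℕ 2 * (n * n * (+ 1 / 8) - e))
                   ≡ n * (n - 1ℚ) - (e + e)
  identity = solve 2 (λ n e →
    n :* n :* con (+ 1 / 2) :+ (n :* (n :- con (fromℕ 4)) :* con (+ 1 / 4)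
                                :+ con (fromℕ 2) :* (n :* n :* con (+ 1 / 8) :- e))
    := n :* (n :- con 1ℚ) :- (e :+ e)) refl

deviation-bound : ∀ {n e ε X W} → 1ℚ ≤ n → 0ℚ ≤ ε → 0ℚ ≤ X →
  e * e ≤ ε * (+ 1 / 64) * (n * n * n) → X ≤ ε * n * (+ 1 / 16) →
  W ≤ fromℕ 2 * ((n - 1ℚ) * (n - 1ℚ) * X) + fromℕ 2 * ((e + e) * (e + e)) →
  n * n * (+ 1 / 2) ≤ n * (n - 1ℚ) - (e + e) →
  n * W ≤ ε * ((n * (n - 1ℚ) - (e + e)) * (n * (n - 1ℚ) - (e + e)))
deviation-bound {n} {e} {ε} {X} {W} 1≤n 0≤ε 0≤X e²≤εn³/64 X≤εn/16 W≤ n²/2≤S = begin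
  n * W
    ≤⟨ *-monoˡ-≤-0≤ 0≤n W≤ ⟩
  n * (fromℕ 2 * ((n - 1ℚ) * (n - 1ℚ) * X) + fromℕ 2 * ((e + e) * (e + e)))
    ≡⟨ cong (λ y → n * (fromℕ 2 * ((n - 1ℚ) * (n - 1ℚ) * X) + fromℕ 2 * y)) (double-square e) ⟩
  n * (fromℕ 2 * ((n - 1ℚ) * (n - 1ℚ) * X) + fromℕ 2 * (fromℕ 4 * (e * e)))
    ≤⟨ *-monoˡ-≤-0≤ 0≤n (+-mono-≤
         (*-monoˡ-≤-0≤ (0≤fromℕ 2) (*-mono-≤-0≤ (0≤p*p (n - 1ℚ)) [n-1]²≤n² 0≤X X≤εn/16))
         (*-monoˡ-≤-0≤ (0≤fromℕ 2) (*-monoˡ-≤-0≤ (0≤fromℕ 4) e²≤εn³/64))) ⟩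
  n * (fromℕ 2 * (n * n * (ε * n * (+ 1 / 16))) + fromℕ 2 * (fromℕ 4 * (ε * (+ 1 / 64) * (n * n * n))))
    ≡⟨ collect n ε ⟩
  ε * ((n * n * (+ 1 / 2)) * (n * n * (+ 1 / 2)))
    ≤⟨ *-monoˡ-≤-0≤ 0≤ε (*-mono-≤-0≤ 0≤n²/2 n²/2≤S 0≤n²/2 n²/2≤S) ⟩
  ε * ((n * (n - 1ℚ) - (e + e)) * (n * (n - 1ℚ) - (e + e))) ∎
  where
  open ≤-Reasoning
  0≤n = ≤-trans (≤ᵇ⇒≤ _) 1≤n
  0≤n-1 = p≤q⇒0≤q-p 1≤n
  0≤n²/2 = *-nonNeg (*-nonNeg 0≤n 0≤n) (0≤n/d 1 1)
  minus-plus : ∀ n → n - 1ℚ + 1ℚ ≡ n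
  minus-plus = solve 1 (λ n → n :- con 1ℚ :+ con 1ℚ := n) refl
  n-1≤n = ≤-by-slack 1ℚ (≤ᵇ⇒≤ _) (minus-plus n)
  [n-1]²≤n² = *-mono-≤-0≤ 0≤n-1 n-1≤n 0≤n-1 n-1≤n
  collect : ∀ n ε →
    n * (fromℕ 2 * (n * n * (ε * n * (+ 1 / 16))) + fromℕ 2 * (fromℕ 4 * (ε * (+ 1 / 64) * (n * n * n))))
    ≡ ε * ((n * n * (+ 1 / 2)) * (n * n * (+ 1 / 2)))
  collect = solve 2 (λ n ε →
    n :* (con (fromℕ 2) :* (n :* n :* (ε :* n :* con (+ 1 / 16)))
          :+ con (fromℕ 2) :* (con (fromℕ 4) :* (ε :* con (+ 1 / 64) :* (n :* n :* n))))
    := ε :* (n :* n :* con (+ 1 / 2) :* (n :* n :* con (+ 1 / 2)))) refl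

ratio-deviation : ∀ {k′ d′} T W n ε → 0ℚ ≤ n →
  0ℚ ≤ fromℕ (suc k′) * T - fromℕ (suc d′) →
  fromℕ (suc k′) * T - fromℕ (suc d′) ≤ fromℕ (suc k′) * W →
  n * W ≤ ε * fromℕ (suc d′) →
  n * ∣ T * 1/ fromℕ (suc d′) - 1/ fromℕ (suc k′) ∣ ≤ ε
ratio-deviation {k′} {d′} T W n ε 0≤n 0≤V V≤KW nW≤εD = begin
  n * ∣ T * R - r ∣      ≡⟨ cong (λ y → n * ∣ y ∣) (sym deviation≡) ⟩
  n * ∣ V * (r * R) ∣    ≡⟨ cong (n *_) (0≤p⇒∣p∣≡p (*-nonNeg 0≤V 0≤rR)) ⟩
  n * (V * (r * R))      ≤⟨ *-monoˡ-≤-0≤ 0≤n (*-monoʳ-≤-0≤ 0≤rR V≤KW) ⟩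
  n * (K * W * (r * R))  ≡⟨ regroup n K W r R ⟩
  n * W * R * (K * r)    ≡⟨ cong (n * W * R *_) (*-inverseʳ K) ⟩
  n * W * R * 1ℚ         ≤⟨ *-monoʳ-≤-nonNeg 1ℚ (*-monoʳ-≤-0≤ 0≤R nW≤εD) ⟩
  ε * D * R * 1ℚ         ≡⟨ trans (*-identityʳ (ε * D * R)) (*-assoc ε D R) ⟩
  ε * (D * R)            ≡⟨ cong (ε *_) (*-inverseʳ D) ⟩
  ε * 1ℚ                 ≡⟨ *-identityʳ ε ⟩
  ε                      ∎
  where
  open ≤-Reasoning
  K = fromℕ (suc k′)
  D = fromℕ (suc d′)
  r = 1/ K
  R = 1/ D
  V = K * T - D
  0≤rR = *-nonNeg (nonNegative⁻¹ r {{pos⇒nonNeg r {{1/pos⇒pos K}}}})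
                  (nonNegative⁻¹ R {{pos⇒nonNeg R {{1/pos⇒pos D}}}})
  0≤R = nonNegative⁻¹ R {{pos⇒nonNeg R {{1/pos⇒pos D}}}}
  expand : ∀ K T D r R → (K * T - D) * (r * R) ≡ T * R * (K * r) - r * (D * R)
  expand = solve 5 (λ K T D r R → (K :* T :- D) :* (r :* R) := T :* R :* (K :* r) :- r :* (D :* R)) refl
  drop-1s : ∀ p q → p * 1ℚ - q * 1ℚ ≡ p - q
  drop-1s = solve 2 (λ p q → p :* con 1ℚ :- q :* con 1ℚ := p :- q) refl
  regroup : ∀ n K W r R → n * (K * W * (r * R)) ≡ n * W * R * (K * r)
  regroup = solve 5 (λ n K W r R → n :* (K :* W :* (r :* R)) := n :* W :* R :* (K :* r)) refl
  deviation≡ : V * (r * R) ≡ T * R - r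
  deviation≡ = begin-equality
    V * (r * R)                    ≡⟨ expand K T D r R ⟩
    T * R * (K * r) - r * (D * R)  ≡⟨ cong₂ (λ y z → T * R * y - r * z) (*-inverseʳ K) (*-inverseʳ D) ⟩
    T * R * 1ℚ - r * 1ℚ            ≡⟨ drop-1s (T * R) r ⟩
    T * R - r                      ∎

∑vol≡edges+edges : ∀ {n k} (G : Graph n) (P : Fin n → Fin k) →
  ∑[ i < k ] fromℕ (vol (adj G) P i) ≡ fromℕ (edgesOf (adj G)) + fromℕ (edgesOf (adj G))
∑vol≡edges+edges {n} {k} G P = begin
  ∑[ i < k ] fromℕ (vol (adj G) P i)                ≡⟨ sym (fromℕ-sumFin k (vol (adj G) P)) ⟩
  fromℕ (sumFin k (vol (adj G) P))                  ≡⟨ cong fromℕ (vol-total (adj G) P) ⟩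
  fromℕ (sumFin n (degOf (adj G)))                  ≡⟨ cong fromℕ (sym (handshake G)) ⟩
  fromℕ (edgesOf (adj G) ℕ.+ edgesOf (adj G))       ≡⟨ fromℕ-homo-+ (edgesOf (adj G)) (edgesOf (adj G)) ⟩
  fromℕ (edgesOf (adj G)) + fromℕ (edgesOf (adj G)) ∎
  where open ≡-Reasoning

0<c+c⇒c≡suc : ∀ c → 0ℚ < fromℕ c + fromℕ c → ∃ λ m → c ≡ suc m
0<c+c⇒c≡suc zero    0<0 = ⊥-elim (<-irrefl refl 0<0)
0<c+c⇒c≡suc (suc m) _   = m , refl

degreeTax-unfold : ∀ {n k} (adj : Fin n → Fin n → Bool) (P : Fin n → Fin k) m →
  edgesOf adj ≡ suc m →
  degreeTax adj P
    ≡ fromℕ (sumFin k (λ i → vol adj P i ℕ.* vol adj P i)) * 1/ fromℕ (4 ℕ.* suc m ℕ.* suc m)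
degreeTax-unfold adj P m edges≡ with edgesOf adj
degreeTax-unfold {k = k} adj P m refl | .(suc m) =
  n/d≡fromℕ*1/fromℕ (sumFin k (λ i → vol adj P i ℕ.* vol adj P i)) (ℕ.pred (4 ℕ.* suc m ℕ.* suc m))

module Profile {n k′} (G : Graph n) (P : Fin n → Fin (suc k′)) where

  k = suc k′
  K = fromℕ k
  N = fromℕ n
  e = fromℕ (edgesOf (adj G))
  ē = fromℕ (edgesOf (adjC G))

  a s v x w : Fin k → ℚ
  a i = fromℕ (partSize P i)
  s i = fromℕ (vol (adj G) P i)
  v i = fromℕ (vol (adjC G) P i)
  x i = a i - N * 1/ K
  w i = (N - 1ℚ) * x i - s i

  X W S : ℚ
  X = ∑[ i < k ] (x i * x i)
  W = ∑[ i < k ] (w i * w i)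
  S = N * (N - 1ℚ) - (e + e)

  part-excess≡x : ∀ i → + partSize P i / 1 - + n / k ≡ x i
  part-excess≡x i = cong₂ _-_ (n/1≡fromℕ (partSize P i)) (n/d≡fromℕ*1/fromℕ n k′)

  sum-a : sum a ≡ N
  sum-a = trans (sym (fromℕ-sumFin k (partSize P))) (cong fromℕ (partSize-total P))

  sum-x : sum x ≡ 0ℚ
  sum-x = begin
    sum x                          ≡⟨ ∑-distrib-− a (λ _ → N * 1/ K) ⟩
    sum a - ∑[ i < k ] (N * 1/ K)  ≡⟨ cong₂ _-_ sum-a (sum-const k (N * 1/ K)) ⟩
    N - K * (N * 1/ K)             ≡⟨ factor N K (1/ K) ⟩
    N * (1ℚ - K * 1/ K)            ≡⟨ cong (λ y → N * (1ℚ - y)) (*-inverseʳ K) ⟩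
    N * (1ℚ - 1ℚ)                  ≡⟨ *-zeroʳ N ⟩
    0ℚ                             ∎
    where
    open ≡-Reasoning
    factor : ∀ N K r → N - K * (N * r) ≡ N * (1ℚ - K * r)
    factor = solve 3 (λ N K r → N :- K :* (N :* r) := N :* (con 1ℚ :- K :* r)) refl

  sum-s : sum s ≡ e + e
  sum-s = ∑vol≡edges+edges G P

  sum-v≡ē+ē : sum v ≡ ē + ē
  sum-v≡ē+ē = ∑vol≡edges+edges (complement G) P

  v≡[N-1]a-s : ∀ i → v i ≡ (N - 1ℚ) * a i - s i
  v≡[N-1]a-s i = solve-for-v (v i) (s i) (a i) N (begin
    v i + s i + a i
      ≡⟨ cong (_+ a i) (sym (fromℕ-homo-+ (vol (adjC G) P i) (vol (adj G) P i))) ⟩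
    fromℕ (vol (adjC G) P i ℕ.+ vol (adj G) P i) + a i
      ≡⟨ sym (fromℕ-homo-+ (vol (adjC G) P i ℕ.+ vol (adj G) P i) (partSize P i)) ⟩
    fromℕ (vol (adjC G) P i ℕ.+ vol (adj G) P i ℕ.+ partSize P i)
      ≡⟨ cong fromℕ (vol-complement G P i) ⟩
    fromℕ (n ℕ.* partSize P i)
      ≡⟨ fromℕ-homo-* n (partSize P i) ⟩
    N * a i ∎)
    where
    open ≡-Reasoning
    isolate : ∀ v s a → v ≡ v + s + a - a - s
    isolate = solve 3 (λ v s a → v := v :+ s :+ a :- a :- s) refl
    rearrange : ∀ N a s → N * a - a - s ≡ (N - 1ℚ) * a - s
    rearrange = solve 3 (λ N a s → N :* a :- a :- s := (N :- con 1ℚ) :* a :- s) refl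
    solve-for-v : ∀ v s a N → v + s + a ≡ N * a → v ≡ (N - 1ℚ) * a - s
    solve-for-v v s a N eq = trans (isolate v s a) (trans (cong (λ y → y - a - s) eq) (rearrange N a s))

  sum-v≡S : sum v ≡ S
  sum-v≡S = begin
    sum v                                ≡⟨ sum-cong-≗ v≡[N-1]a-s ⟩
    ∑[ i < k ] ((N - 1ℚ) * a i - s i)    ≡⟨ ∑-distrib-− (λ i → (N - 1ℚ) * a i) s ⟩
    ∑[ i < k ] ((N - 1ℚ) * a i) - sum s  ≡⟨ cong₂ _-_ (sym (*-distribˡ-sum (N - 1ℚ) a)) sum-s ⟩
    (N - 1ℚ) * sum a - (e + e)           ≡⟨ cong (λ y → (N - 1ℚ) * y - (e + e)) sum-a ⟩
    (N - 1ℚ) * N - (e + e)               ≡⟨ cong (_- (e + e)) (*-comm (N - 1ℚ) N) ⟩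
    S                                    ∎
    where open ≡-Reasoning

  scaledVariance-v≡w : scaledVariance v ≡ scaledVariance w
  scaledVariance-v≡w = trans (scaledVariance-cong v≡c+w) (scaledVariance-translate c w)
    where
    c = (N - 1ℚ) * (N * 1/ K)
    split : ∀ M a s m → M * a - s ≡ M * m + (M * (a - m) - s)
    split = solve 4 (λ M a s m → M :* a :- s := M :* m :+ (M :* (a :- m) :- s)) refl
    v≡c+w : ∀ i → v i ≡ c + w i
    v≡c+w i = trans (v≡[N-1]a-s i) (split (N - 1ℚ) (a i) (s i) (N * 1/ K))

  W≤ : W ≤ fromℕ 2 * ((N - 1ℚ) * (N - 1ℚ) * X) + fromℕ 2 * ((e + e) * (e + e))
  W≤ = begin
    W
      ≤⟨ ∑-mono-≤ (λ i → sq-diff≤ ((N - 1ℚ) * x i) (s i)) ⟩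
    ∑[ i < k ] (two * ((N - 1ℚ) * x i * ((N - 1ℚ) * x i)) + two * (s i * s i))
      ≡⟨ ∑-distrib-+ (λ i → two * ((N - 1ℚ) * x i * ((N - 1ℚ) * x i))) (λ i → two * (s i * s i)) ⟩
    ∑[ i < k ] (two * ((N - 1ℚ) * x i * ((N - 1ℚ) * x i))) + ∑[ i < k ] (two * (s i * s i))
      ≡⟨ cong₂ _+_ (trans (sum-cong-≗ (λ i → reassoc (N - 1ℚ) (x i)))
                          (sym (*-distribˡ-sum (two * ((N - 1ℚ) * (N - 1ℚ))) (λ i → x i * x i))))
                   (sym (*-distribˡ-sum two (λ i → s i * s i))) ⟩
    two * ((N - 1ℚ) * (N - 1ℚ)) * X + two * ∑[ i < k ] (s i * s i)
      ≤⟨ +-mono-≤ (≤-reflexive (*-assoc two ((N - 1ℚ) * (N - 1ℚ)) X))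
                  (*-monoˡ-≤-0≤ (0≤fromℕ 2) (≤-trans (sum-sq≤sq-sum s (λ i → 0≤fromℕ _))
                                                     (≤-reflexive (cong (λ y → y * y) sum-s)))) ⟩
    two * ((N - 1ℚ) * (N - 1ℚ) * X) + two * ((e + e) * (e + e)) ∎
    where
    open ≤-Reasoning
    two = fromℕ 2
    reassoc : ∀ M y → two * (M * y * (M * y)) ≡ two * (M * M) * (y * y)
    reassoc = solve 2 (λ M y → con two :* (M :* y :* (M :* y)) := con two :* (M :* M) :* (y :* y)) refl

  tax-deviation-≤ : ∀ ε → 0ℚ < S → N * W ≤ ε * (S * S) →
    N * ∣ degreeTax (adjC G) P - + 1 / k ∣ ≤ ε
  tax-deviation-≤ ε 0<S NW≤εS² =
    at-count (0<c+c⇒c≡suc (edgesOf (adjC G)) (subst (0ℚ <_) (trans (sym sum-v≡S) sum-v≡ē+ē) 0<S))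
    where
    at-count : (∃ λ m → edgesOf (adjC G) ≡ suc m) → N * ∣ degreeTax (adjC G) P - + 1 / k ∣ ≤ ε
    at-count (m , ē≡1+m) = subst₂ (λ t u → N * ∣ t - u ∣ ≤ ε)
      (sym (degreeTax-unfold (adjC G) P m ē≡1+m))
      (sym (trans (n/d≡fromℕ*1/fromℕ 1 k′) (*-identityˡ (1/ K))))
      (ratio-deviation T W N ε (0≤fromℕ n)
        (subst (0ℚ ≤_) (sym KT-D≡) (scaledVariance-nonNeg w))
        (subst (_≤ K * W) (sym KT-D≡) (scaledVariance≤k*sum-sq w))
        (subst (λ y → N * W ≤ ε * y) (sym D≡S²) NW≤εS²))
      where
      open ≡-Reasoning
      vol² : Fin k → ℕ
      vol² i = vol (adjC G) P i ℕ.* vol (adjC G) P i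
      T = fromℕ (sumFin k vol²)
      M = fromℕ (suc m)
      D = fromℕ (4 ℕ.* suc m ℕ.* suc m)
      D≡S² : D ≡ S * S
      D≡S² = begin
        D                      ≡⟨ fromℕ-homo-* (4 ℕ.* suc m) (suc m) ⟩
        fromℕ (4 ℕ.* suc m) * M ≡⟨ cong (_* M) (fromℕ-homo-* 4 (suc m)) ⟩
        fromℕ 4 * M * M        ≡⟨ *-assoc (fromℕ 4) M M ⟩
        fromℕ 4 * (M * M)      ≡⟨ sym (double-square M) ⟩
        (M + M) * (M + M)      ≡⟨ cong (λ y → (y + y) * (y + y)) (cong fromℕ (sym ē≡1+m)) ⟩
        (ē + ē) * (ē + ē)      ≡⟨ cong (λ y → y * y) (trans (sym sum-v≡ē+ē) sum-v≡S) ⟩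
        S * S                  ∎
      KT-D≡ : K * T - D ≡ scaledVariance w
      KT-D≡ = begin
        K * T - D
          ≡⟨ cong (λ t → K * t - D) (fromℕ-sumFin k vol²) ⟩
        K * ∑[ i < k ] fromℕ (vol² i) - D
          ≡⟨ cong₂ (λ t d → K * t - d)
               (sum-cong-≗ (λ i → fromℕ-homo-* (vol (adjC G) P i) (vol (adjC G) P i)))
               (trans D≡S² (cong (λ y → y * y) (sym sum-v≡S))) ⟩
        scaledVariance v
          ≡⟨ scaledVariance-v≡w ⟩
        scaledVariance w ∎

  tax-deviation : ∀ ε → 0ℚ ≤ ε → ε ≤ 1ℚ → 4 ℕ.≤ n →
    e * e ≤ ε * (+ 1 / 64) * (N * N * N) →
    (∀ i → (x i ≤ 0ℚ) ⊎ (x i * x i ≤ ε * (1/ K * 1/ K) * (+ 1 / 64) * N)) →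
    N * ∣ degreeTax (adjC G) P - + 1 / k ∣ ≤ ε
  tax-deviation ε 0≤ε ε≤1 4≤n e²≤εN³/64 x-one-sided = tax-deviation-≤ ε 0<S
    (deviation-bound {N} {e} {ε} 1≤N 0≤ε (∑-nonNeg (λ i → 0≤p*p (x i)))
                     e²≤εN³/64 X≤εN/16 W≤ N²/2≤S)
    where
    1≤N : 1ℚ ≤ N
    1≤N = fromℕ-mono-≤ (ℕP.≤-trans (ℕ.s≤s ℕ.z≤n) 4≤n)
    N²/2≤S : N * N * (+ 1 / 2) ≤ S
    N²/2≤S = n²/2≤n[n-1]-2e (fromℕ-mono-≤ 4≤n) (edges-≤-n²/8 {N} {e} {ε} 1≤N ε≤1 e²≤εN³/64)
    0<S : 0ℚ < S
    0<S = <-≤-trans (positive⁻¹ (+ 1 / 2))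
      (≤-trans (*-monoʳ-≤-nonNeg (+ 1 / 2) (*-mono-≤-0≤ (≤ᵇ⇒≤ _) 1≤N (≤ᵇ⇒≤ _) 1≤N))
               N²/2≤S)
    δN = ε * (1/ K * 1/ K) * (+ 1 / 64) * N
    regroup : ∀ K r ε N → fromℕ 4 * (K * (K * (ε * (r * r) * (+ 1 / 64) * N)))
                        ≡ (K * r) * (K * r) * (ε * N * (+ 1 / 16))
    regroup = solve 4 (λ K r ε N → con (fromℕ 4) :* (K :* (K :* (ε :* (r :* r) :* con (+ 1 / 64) :* N)))
                                 := K :* r :* (K :* r) :* (ε :* N :* con (+ 1 / 16))) refl
    X≤εN/16 : X ≤ ε * N * (+ 1 / 16)
    X≤εN/16 = begin
      X                                  ≤⟨ balanced-sum-sq-bound x δN 0≤δN sum-x x-one-sided ⟩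
      fromℕ 4 * (K * (K * δN))           ≡⟨ regroup K (1/ K) ε N ⟩
      (K * 1/ K) * (K * 1/ K) * εN/16    ≡⟨ cong (λ y → y * y * εN/16) (*-inverseʳ K) ⟩
      1ℚ * 1ℚ * εN/16                    ≡⟨ *-identityˡ εN/16 ⟩
      εN/16                              ∎
      where
      open ≤-Reasoning
      εN/16 = ε * N * (+ 1 / 16)
      0≤δN = *-nonNeg (*-nonNeg (*-nonNeg 0≤ε (0≤p*p (1/ K))) (0≤n/d 1 63)) (0≤fromℕ n)

lemma3p1 : (k : ℕ) → .{{_ : NonZero k}} → k ≥ 2 →
    (G : (n : ℕ) → Graph n) → (P : (n : ℕ) → Fin n → Fin k) →
    -- e(G_n) = o(n^{3/2}), i.e. e(G_n)² = o(n³)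
    ((ε : ℚ) → 0ℚ < ε → Σ ℕ (λ N → (n : ℕ) → n ≥ N →
      (+ edgesOf (adj (G n)) / 1) * (+ edgesOf (adj (G n)) / 1) ≤ ε * (+ (n Data.Nat.* n Data.Nat.* n) / 1))) →
    -- max_i |A_i| ≤ n/k + o(√n): the excess x = |A_i| - n/k is ≤ 0 or x² ≤ ε n eventually
    ((ε : ℚ) → 0ℚ < ε → Σ ℕ (λ N → (n : ℕ) → n ≥ N → (i : Fin k) →
      ((+ partSize (P n) i / 1) - (+ n / k) ≤ 0ℚ) ⊎
      (((+ partSize (P n) i / 1) - (+ n / k)) * ((+ partSize (P n) i / 1) - (+ n / k)) ≤ ε * (+ n / 1)))) →
    -- q^D_A(Ḡ_n) = 1/k + o(1/n)
    ((ε : ℚ) → 0ℚ < ε → Σ ℕ (λ N → (n : ℕ) → n ≥ N →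
      (+ n / 1) * ∣ degreeTax (adjC (G n)) (P n) - (+ 1 / k) ∣ ≤ ε))
lemma3p1 (suc k′) _ G P edges-sparse parts-balanced ε 0<ε = N₁ ℕ.+ N₂ ℕ.+ 4 , eventually
  where
  -- Capping ε at 1 keeps e ≤ n²/8, which is what bounds (Σ v_i)² from below.
  ε₀ = ε ⊓ 1ℚ
  0<ε₀ = 0<⊓ 0<ε (positive⁻¹ 1ℚ)
  r = 1/ fromℕ (suc k′)
  0<r = positive⁻¹ r {{1/pos⇒pos (fromℕ (suc k′))}}
  sparse = edges-sparse (ε₀ * (+ 1 / 64)) (*-pos 0<ε₀ (positive⁻¹ (+ 1 / 64)))
  balanced = parts-balanced (ε₀ * (r * r) * (+ 1 / 64))
    (*-pos (*-pos 0<ε₀ (*-pos 0<r 0<r)) (positive⁻¹ (+ 1 / 64)))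
  N₁ = proj₁ sparse
  N₂ = proj₁ balanced
  eventually : (n : ℕ) → n ≥ N₁ ℕ.+ N₂ ℕ.+ 4 →
    + n / 1 * ∣ degreeTax (adjC (G n)) (P n) - + 1 / suc k′ ∣ ≤ ε
  eventually n n≥N = subst (λ y → y * ∣ degreeTax (adjC (G n)) (P n) - + 1 / suc k′ ∣ ≤ ε)
    (sym (n/1≡fromℕ n))
    (≤-trans (tax-deviation ε₀ (<⇒≤ 0<ε₀) (p⊓q≤q ε 1ℚ) 4≤n e²-bound x-bound) (p⊓q≤p ε 1ℚ))
    where
    open Profile (G n) (P n)
    N₁+N₂≤n = ℕP.m+n≤o⇒m≤o (N₁ ℕ.+ N₂) n≥N
    4≤n = ℕP.m+n≤o⇒n≤o (N₁ ℕ.+ N₂) n≥N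
    e²-bound = subst₂ (λ y z → y * y ≤ ε₀ * (+ 1 / 64) * z)
      (n/1≡fromℕ (edgesOf (adj (G n)))) (n³/1≡fromℕ³ n)
      (proj₂ sparse n (ℕP.m+n≤o⇒m≤o N₁ N₁+N₂≤n))
    x-bound = λ i → Data.Sum.map (subst (_≤ 0ℚ) (part-excess≡x i))
      (subst₂ (λ y z → y * y ≤ ε₀ * (r * r) * (+ 1 / 64) * z) (part-excess≡x i) (n/1≡fromℕ n))
      (proj₂ balanced n (ℕP.m+n≤o⇒n≤o N₁ N₁+N₂≤n) i)
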